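{- Let $T$ be an oriented tree. If there exists an integer $d$ such that every finite digraph $G$ with $\delta^+(G)\geq d$ contains $T$ as a subgraph, then $T$ is grounded, i.e. its height function $h_T$ takes the same value on all vertices of $T$ of in-degree at least $2$.
   Context: All digraphs are finite, without loops or multiple copies of the same edge (two oppositely oriented edges between a pair of vertices are allowed). $\delta^+(G)$ is the minimum out-degree of $G$. An oriented tree is an orientation of an undirected tree. The height function of an oriented tree $T$ is a function $h_T\colon V(T)\to\mathbb{Z}$ with $h_T(v)=h_T(u)+1$ for every edge $(u,v)\in E(T)$; it is unique up to an additive constant. $T$ is grounded if $h_T$ is constant on $\{v\in V(T):\deg^-(v)\geq 2\}$ (vacuously grounded if this set is empty). -}

module Defs where

open import Data.Nat using (ℕ; zero; suc; _≤_; _+_)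
open import Data.Fin using (Fin)
open import Data.Bool using (Bool; true; false; T)
open import Data.List using (List; []; _∷_; length; filter)
open import Data.List.Membership.Propositional using (_∈_)
open import Data.Vec.Functional using (Vector)
open import Data.Fin.Subset using (Subset; ∣_∣)
open import Data.Vec using (tabulate)
open import Data.Integer using (ℤ)
import Data.Integer as ℤ
open import Data.Product using (Σ; _×_; _,_; ∃)
open import Data.Sum using (_⊎_)
open import Relation.Binary.PropositionalEquality using (_≡_)
open import Relation.Nullary using (¬_)
open import Function.Definitions using (Injective)

-- Two opposite edges between a pair of vertices are allowed.
record Digraph (n : ℕ) : Set where
  field
    adj      : Fin n → Fin n → Bool
    loopless : ∀ v → adj v v ≡ false
open Digraph public

Edge : ∀ {n} → Digraph n → Fin n → Fin n → Set
Edge G u v = T (adj G u v)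

outdeg : ∀ {n} → Digraph n → Fin n → ℕ
outdeg G u = ∣ tabulate (λ v → adj G u v) ∣

indeg : ∀ {n} → Digraph n → Fin n → ℕ
indeg G v = ∣ tabulate (λ u → adj G u v) ∣

MinOutDeg≥ : ∀ {n} → Digraph n → ℕ → Set
MinOutDeg≥ G d = ∀ u → d ≤ outdeg G u

UAdj : ∀ {n} → Digraph n → Fin n → Fin n → Set
UAdj G u v = Edge G u v ⊎ Edge G v u

data UWalk {n} (G : Digraph n) : Fin n → Fin n → Set where
  here : ∀ {u} → UWalk G u u
  step : ∀ {u v w} → UAdj G u v → UWalk G v w → UWalk G u w

edgeCount : ∀ {n} → Digraph n → ℕ
edgeCount {zero}  G = 0
edgeCount {suc n} G = sumFin (λ u → outdeg G u)
  where
    sumFin : ∀ {k} → (Fin k → ℕ) → ℕ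
    sumFin {zero}  f = 0
    sumFin {suc k} f = f Fin.zero + sumFin (λ i → f (Fin.suc i))

-- An oriented tree on m vertices (m ≥ 1): an orientation of an undirected tree,
-- i.e. no pair of opposite edges, the underlying graph is connected and has
-- exactly m - 1 edges.
record IsOrientedTree {m : ℕ} (Tr : Digraph (suc m)) : Set where
  field
    oriented  : ∀ u v → Edge Tr u v → ¬ Edge Tr v u
    connected : ∀ u v → UWalk Tr u v
    edges     : edgeCount Tr ≡ m

Contains : ∀ {n m} → Digraph n → Digraph m → Set
Contains {n} {m} G Tr =
  Σ (Fin m → Fin n) λ φ → Injective _≡_ _≡_ φ × (∀ u v → Edge Tr u v → Edge G (φ u) (φ v))

IsHeightFunction : ∀ {m} → Digraph m → (Fin m → ℤ) → Set
IsHeightFunction Tr h = ∀ u v → Edge Tr u v → h v ≡ h u ℤ.+ ℤ.1ℤ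

-- grounded: the height function is constant on vertices of in-degree ≥ 2
-- (stated for every height function; they differ by additive constants)
Grounded : ∀ {m} → Digraph m → Set
Grounded Tr = ∀ h → IsHeightFunction Tr h →
  ∀ u v → 2 ≤ indeg Tr u → 2 ≤ indeg Tr v → h u ≡ h v

-- Suppose T is not grounded: two vertices u, v of in-degree ≥ 2 have heights
-- differing by δ ≠ 0. For a > d take a copies of the complete a-ary tree of
-- depth K + 1 and add an arc from every leaf to every root. Every vertex has
-- out-degree ≥ a, every non-root has exactly one in-neighbour, and depth
-- increases by 1 modulo K + 2 along every arc. In an embedding of T the height
-- minus the depth of the image is therefore constant modulo K + 2 (T is
-- connected), and u, v, having two in-neighbours, land on roots. So K + 2
-- divides δ, which fails for K = ∣δ∣.
module Submission where

open import Data.Bool using (Bool; T)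
open import Data.Bool.Properties using (T-≡)
open import Data.Fin using (Fin; suc)
import Data.Fin.Properties as Finₚ
open import Data.Fin.Properties using (suc-injective; 0≢1+n; 1↔⊤; +↔⊎; *↔×)
open import Data.Fin.Subset using (Subset; _∈_; ∣_∣; ⁅_⁆; ⊤; inside; outside)
open import Data.Fin.Subset.Properties
  using (x∈p∧x≢y⇒x∈p-y; x∈p⇒∣p-x∣<∣p∣; p⊆q⇒∣p∣≤∣q∣; ∣⁅x⁆∣≡1; ∣⊤∣≡n; x∈⁅x⁆)
open import Data.Integer using (ℤ; +_; 0ℤ; 1ℤ; _+_; _-_; -_)
import Data.Integer as ℤ using (∣_∣)
open import Data.Integer.Divisibility.Signed using (_∣_; ∣ᵤ⇒∣; ∣⇒∣ᵤ; ∣-refl; ∣m∣n⇒∣m+n; ∣m⇒∣-m)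
open import Data.Integer.Properties
  using (+-minus-telescope; +-inverseʳ; +-identityˡ; ∣i∣≡0⇒i≡0; i-j≡0⇒i≡j)
open import Data.Integer.Tactic.RingSolver using (solve-∀)
open import Data.Nat using (ℕ; zero; suc; _*_; _<_; _≤_; z≤n; s≤s)
open import Data.Nat.Divisibility using (>⇒∤) renaming (_∣_ to _∣ℕ_; _∣0 to _∣ℕ0)
import Data.Nat.Properties as ℕ
open import Data.Product using (Σ; _×_; _,_; proj₁; proj₂; map₂)
open import Data.Product.Function.NonDependent.Propositional using (_×-↔_)
open import Data.Sum using (_⊎_; inj₁; inj₂)
open import Data.Sum.Function.Propositional using (_⊎-↔_)
open import Data.Unit using (tt) renaming (⊤ to Unit)
open import Data.Vec using ([]; _∷_; tabulate; here; there)
open import Data.Vec.Properties using (lookup∘tabulate; lookup⇒[]=; []=⇒lookup)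
open import Function using (_∘_)
open import Function.Bundles using (_↔_; Inverse; Injection; Equivalence; mk↔ₛ′)
open import Function.Definitions using (Injective)
open import Function.Properties.Inverse using (↔-refl; ↔-sym; ↔-trans; ↔⇒↣)
open import Function.Related.Propositional using (module EquationalReasoning)
open import Relation.Binary.PropositionalEquality using (_≡_; refl; sym; trans; cong; cong₂; subst; module ≡-Reasoning)
open import Relation.Nullary using (¬_; Dec; yes; no; contradiction)
open import Relation.Nullary.Decidable
  using (_×-dec_; _⊎-dec_; ⌊_⌋; isYes≗does; dec-false; toWitness; fromWitness)

open import Defs

∈-tabulate⁺ : ∀ {n} {f : Fin n → Bool} {x} → T (f x) → x ∈ tabulate f
∈-tabulate⁺ {f = f} {x} fx =
  lookup⇒[]= x (tabulate f) (trans (lookup∘tabulate f x) (Equivalence.to T-≡ fx))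

∈-tabulate⁻ : ∀ {n} {f : Fin n → Bool} {x} → x ∈ tabulate f → T (f x)
∈-tabulate⁻ {f = f} {x} x∈ =
  Equivalence.from T-≡ (trans (sym (lookup∘tabulate f x)) ([]=⇒lookup x∈))

injective⇒∣p∣≤∣q∣ : ∀ {m n} {p : Subset m} {q : Subset n} (f : Fin m → Fin n) →
  Injective _≡_ _≡_ f → (∀ {x} → x ∈ p → f x ∈ q) → ∣ p ∣ ≤ ∣ q ∣
injective⇒∣p∣≤∣q∣ {p = []}          f _   _  = z≤n
injective⇒∣p∣≤∣q∣ {p = outside ∷ p} f inj f∈ =
  injective⇒∣p∣≤∣q∣ (f ∘ suc) (suc-injective ∘ inj) (f∈ ∘ there)
injective⇒∣p∣≤∣q∣ {p = inside ∷ p}  f inj f∈ =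
  ℕ.≤-<-trans
    (injective⇒∣p∣≤∣q∣ (f ∘ suc) (suc-injective ∘ inj)
      (λ x∈p → x∈p∧x≢y⇒x∈p-y (f∈ (there x∈p)) (0≢1+n ∘ sym ∘ inj)))
    (x∈p⇒∣p-x∣<∣p∣ (f∈ here))

injection⇒outdeg≥ : ∀ {n d} (G : Digraph n) u (ψ : Fin d → Fin n) →
  Injective _≡_ _≡_ ψ → (∀ c → Edge G u (ψ c)) → d ≤ outdeg G u
injection⇒outdeg≥ {d = d} G u ψ ψ-injective ψ-edge = subst (_≤ outdeg G u) (∣⊤∣≡n d)
  (injective⇒∣p∣≤∣q∣ {p = ⊤} ψ ψ-injective (λ {c} _ → ∈-tabulate⁺ (ψ-edge c)))

unique-in-neighbour⇒indeg≤1 : ∀ {n} (G : Digraph n) v w → (∀ u → Edge G u v → u ≡ w) → indeg G v ≤ 1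
unique-in-neighbour⇒indeg≤1 G v w unique = subst (indeg G v ≤_) (∣⁅x⁆∣≡1 w)
  (p⊆q⇒∣p∣≤∣q∣ (λ {u} u∈ → subst (_∈ ⁅ w ⁆) (sym (unique u (∈-tabulate⁻ u∈))) (x∈⁅x⁆ w)))

Contains⇒indeg≤ : ∀ {m n} {G : Digraph n} {Tr : Digraph m} (embedding : Contains G Tr) →
  ∀ v → indeg Tr v ≤ indeg G (proj₁ embedding v)
Contains⇒indeg≤ (φ , φ-injective , φ-edge) v =
  injective⇒∣p∣≤∣q∣ φ φ-injective (λ {u} u∈ → ∈-tabulate⁺ (φ-edge u v (∈-tabulate⁻ u∈)))

IsHeightFunctionModulo : ∀ {n} → ℕ → Digraph n → (Fin n → ℤ) → Set
IsHeightFunctionModulo k G ℓ = ∀ u v → Edge G u v → + k ∣ ℓ v - (ℓ u + 1ℤ)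

∣-difference-along-walk : ∀ {n} {G : Digraph n} {k} (g : Fin n → ℤ) →
  (∀ u v → Edge G u v → k ∣ g v - g u) → ∀ {u v} → UWalk G u v → k ∣ g v - g u
∣-difference-along-walk {k = k} g edge {u} here =
  subst (k ∣_) (sym (+-inverseʳ (g u))) (∣ᵤ⇒∣ (ℤ.∣ k ∣ ∣ℕ0))
∣-difference-along-walk {G = G} {k} g edge {u} (step {v = v} {w} u~v walk) =
  subst (k ∣_) (+-minus-telescope (g w) (g v) (g u))
    (∣m∣n⇒∣m+n (∣-difference-along-walk g edge walk) (first-step u~v))
  where
  swap : ∀ x y → - (x - y) ≡ y - x
  swap = solve-∀
  first-step : UAdj G u v → k ∣ g v - g u
  first-step (inj₁ u→v) = edge u v u→v
  first-step (inj₂ v→u) = subst (k ∣_) (swap (g u) (g v)) (∣m⇒∣-m (edge v u v→u))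

merging-heights-congruent :
  ∀ {m n k} {Tr : Digraph m} {G : Digraph n} {h : Fin m → ℤ} {ℓ : Fin n → ℤ} →
  (∀ u v → UWalk Tr u v) → Contains G Tr →
  IsHeightFunction Tr h → IsHeightFunctionModulo k G ℓ → (∀ x → 2 ≤ indeg G x → ℓ x ≡ 0ℤ) →
  ∀ u v → 2 ≤ indeg Tr u → 2 ≤ indeg Tr v → + k ∣ h u - h v
merging-heights-congruent {m} {k = k} {Tr} {G} {h} {ℓ}
  connected embedding@(φ , _ , φ-edge) h-height ℓ-height ℓ-merge u v u-merge v-merge =
  subst (+ k ∣_)
    (trans (cong₂ (λ x y → (x - h v) - (y - h u)) (ℓφ-merge v v-merge) (ℓφ-merge u u-merge))
           (cancel (h u) (h v)))
    (∣-difference-along-walk g drift (connected u v))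
  where
  g : Fin m → ℤ
  g t = ℓ (φ t) - h t

  regroup : ∀ x y z → x - (y + 1ℤ) ≡ (x - (z + 1ℤ)) - (y - z)
  regroup = solve-∀

  cancel : ∀ x y → (0ℤ - y) - (0ℤ - x) ≡ x - y
  cancel = solve-∀

  drift : ∀ t t′ → Edge Tr t t′ → + k ∣ g t′ - g t
  drift t t′ e = subst (+ k ∣_)
    (trans (regroup (ℓ (φ t′)) (ℓ (φ t)) (h t)) (cong (λ x → (ℓ (φ t′) - x) - g t) (sym (h-height t t′ e))))
    (ℓ-height (φ t) (φ t′) (φ-edge t t′ e))

  ℓφ-merge : ∀ t → 2 ≤ indeg Tr t → ℓ (φ t) ≡ 0ℤ
  ℓφ-merge t t-merge = ℓ-merge (φ t) (ℕ.≤-trans t-merge (Contains⇒indeg≤ {G = G} {Tr} embedding t))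

k∣i∧∣i∣<k⇒i≡0 : ∀ {k i} → + k ∣ i → ℤ.∣ i ∣ < k → i ≡ 0ℤ
k∣i∧∣i∣<k⇒i≡0 k∣i ∣i∣<k = ∣i∣≡0⇒i≡0 (m∣n∧n<m⇒n≡0 (∣⇒∣ᵤ k∣i) ∣i∣<k)
  where
  m∣n∧n<m⇒n≡0 : ∀ {m n} → m ∣ℕ n → n < m → n ≡ 0
  m∣n∧n<m⇒n≡0 {n = zero}  _   _   = refl
  m∣n∧n<m⇒n≡0 {n = suc _} m∣n n<m = contradiction m∣n (>⇒∤ n<m)

-- Words of length at most K, first letter outermost: the vertices of the
-- complete a-ary tree of depth K, a word being the path from the root.
data Word (a : ℕ) : ℕ → Set where
  []  : ∀ {K} → Word a K
  _∷_ : ∀ {K} → Fin a → Word a K → Word a (suc K)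

∣Word∣ : ℕ → ℕ → ℕ
∣Word∣ a zero    = 1
∣Word∣ a (suc K) = suc (a * ∣Word∣ a K)

module _ {a : ℕ} where

  depth : ∀ {K} → Word a K → ℕ
  depth []      = 0
  depth (_ ∷ w) = suc (depth w)

  depth≤ : ∀ {K} (w : Word a K) → depth w ≤ K
  depth≤ []      = z≤n
  depth≤ (_ ∷ w) = s≤s (depth≤ w)

  -- Appending to a word of full length K returns it unchanged.
  infixl 5 _∷ʳ_
  _∷ʳ_ : ∀ {K} → Word a K → Fin a → Word a K
  _∷ʳ_ {zero}  [] c = []
  _∷ʳ_ {suc K} [] c = c ∷ []
  (b ∷ w) ∷ʳ c      = b ∷ (w ∷ʳ c)

  init : ∀ {K} → Word a K → Word a K
  init []              = []
  init (_ ∷ [])        = []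
  init (b ∷ w@(_ ∷ _)) = b ∷ init w

  depth-∷ʳ : ∀ {K} (w : Word a K) c → depth w < K → depth (w ∷ʳ c) ≡ suc (depth w)
  depth-∷ʳ {suc K} []      c _        = refl
  depth-∷ʳ         (b ∷ w) c (s≤s lt) = cong suc (depth-∷ʳ w c lt)

  init-∷ʳ : ∀ {K} (w : Word a K) c → depth w < K → init (w ∷ʳ c) ≡ w
  init-∷ʳ {suc K}       []              c _        = refl
  init-∷ʳ {suc (suc K)} (b ∷ [])        c _        = refl
  init-∷ʳ {suc zero}    (b ∷ [])        c (s≤s ())
  init-∷ʳ               (b ∷ w@(_ ∷ _)) c (s≤s lt) = cong (b ∷_) (init-∷ʳ w c lt)

  ∷ʳ-injectiveʳ : ∀ {K} (w : Word a K) {c c′} → depth w < K → w ∷ʳ c ≡ w ∷ʳ c′ → c ≡ c′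
  ∷ʳ-injectiveʳ {suc K} []      _        refl = refl
  ∷ʳ-injectiveʳ         (b ∷ w) (s≤s lt) eq   = ∷ʳ-injectiveʳ w lt (∷-injectiveʳ eq)
    where
    ∷-injectiveʳ : ∀ {K} {b b′ : Fin a} {u v : Word a K} → b ∷ u ≡ b′ ∷ v → u ≡ v
    ∷-injectiveʳ refl = refl

  Word↔Fin : ∀ K → Word a K ↔ Fin (∣Word∣ a K)
  Word↔Fin zero    = ↔-trans (mk↔ₛ′ (λ _ → tt) (λ _ → []) (λ _ → refl) (λ { [] → refl })) (↔-sym 1↔⊤)
  Word↔Fin (suc K) = begin
    Word a (suc K)                         ↔⟨ unfold ⟩
    (Unit ⊎ (Fin a × Word a K))            ↔⟨ ↔-sym 1↔⊤ ⊎-↔ (↔-refl ×-↔ Word↔Fin K) ⟩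
    (Fin 1 ⊎ (Fin a × Fin (∣Word∣ a K)))   ↔⟨ ↔-refl ⊎-↔ ↔-sym *↔× ⟩
    (Fin 1 ⊎ Fin (a * ∣Word∣ a K))         ↔⟨ ↔-sym +↔⊎ ⟩
    Fin (∣Word∣ a (suc K))                 ∎
    where
    open EquationalReasoning
    unfold : Word a (suc K) ↔ (Unit ⊎ (Fin a × Word a K))
    unfold = mk↔ₛ′ (λ { [] → inj₁ tt ; (c ∷ w) → inj₂ (c , w) })
                   (λ { (inj₁ _) → [] ; (inj₂ (c , w)) → c ∷ w })
                   (λ { (inj₁ _) → refl ; (inj₂ _) → refl })
                   (λ { [] → refl ; (_ ∷ _) → refl })

+m+1≡+[1+m] : ∀ m → + m + 1ℤ ≡ + suc m
+m+1≡+[1+m] m = cong +_ (ℕ.+-comm m 1)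

successor-mod⇒∣ : ∀ {k m n} → (suc m ≡ k × n ≡ 0) ⊎ n ≡ suc m → + k ∣ + n - (+ m + 1ℤ)
successor-mod⇒∣ {m = m} (inj₁ (refl , refl)) =
  subst (+ suc m ∣_) (sym (+-identityˡ (- (+ m + 1ℤ))))
    (∣m⇒∣-m (subst (+ suc m ∣_) (sym (+m+1≡+[1+m] m)) ∣-refl))
successor-mod⇒∣ {k} {m} (inj₂ refl) =
  subst (+ k ∣_) (sym (trans (cong (_- (+ m + 1ℤ)) (sym (+m+1≡+[1+m] m))) (+-inverseʳ (+ m + 1ℤ))))
    (∣ᵤ⇒∣ {+ k} (k ∣ℕ0))

module CyclicForest (a K : ℕ) where

  order : ℕ
  order = a * ∣Word∣ a (suc K)

  vertex↔ : (Fin a × Word a (suc K)) ↔ Fin order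
  vertex↔ = ↔-trans (↔-refl ×-↔ Word↔Fin (suc K)) (↔-sym *↔×)

  open Inverse vertex↔ using (to; from; strictlyInverseˡ; strictlyInverseʳ)

  to-injective : Injective _≡_ _≡_ to
  to-injective = Injection.injective (↔⇒↣ vertex↔)

  depthOf : Fin order → ℕ
  depthOf x = depth (proj₂ (from x))

  depthOf-to : ∀ r w → depthOf (to (r , w)) ≡ depth w
  depthOf-to r w = cong (depth ∘ proj₂) (strictlyInverseʳ (r , w))

  parent : Fin order → Fin order
  parent x = to (map₂ init (from x))

  Arc : Fin order → Fin order → Set
  Arc x y = (depthOf x ≡ suc K × depthOf y ≡ 0) ⊎ (x ≡ parent y × depthOf y ≡ suc (depthOf x))

  arc? : ∀ x y → Dec (Arc x y)
  arc? x y = (depthOf x ℕ.≟ suc K ×-dec depthOf y ℕ.≟ 0)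
       ⊎-dec (x Finₚ.≟ parent y ×-dec depthOf y ℕ.≟ suc (depthOf x))

  Arc-irreflexive : ∀ x → ¬ Arc x x
  Arc-irreflexive x (inj₁ (leaf , root)) = ℕ.1+n≢0 (trans (sym leaf) root)
  Arc-irreflexive x (inj₂ (_ , deeper))  = ℕ.1+n≢n (sym deeper)

  graph : Digraph order
  graph = record
    { adj      = λ x y → ⌊ arc? x y ⌋
    ; loopless = λ x → trans (isYes≗does (arc? x x)) (dec-false (arc? x x) (Arc-irreflexive x))
    }

  Arc⇒Edge : ∀ {x y} → Arc x y → Edge graph x y
  Arc⇒Edge {x} {y} = fromWitness {a? = arc? x y}

  Edge⇒Arc : ∀ {x y} → Edge graph x y → Arc x y
  Edge⇒Arc {x} {y} = toWitness {a? = arc? x y}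

  leaf-outdeg≥ : ∀ x → depthOf x ≡ suc K → a ≤ outdeg graph x
  leaf-outdeg≥ x leaf = injection⇒outdeg≥ graph x root
    (λ {c} {c′} e → cong proj₁ (to-injective {c , []} {c′ , []} e))
    (λ c → Arc⇒Edge (inj₁ (leaf , depthOf-to c [])))
    where
    root : Fin a → Fin order
    root c = to (c , [])

  inner-outdeg≥ : ∀ r w → depth w < suc K → a ≤ outdeg graph (to (r , w))
  inner-outdeg≥ r w shallow = injection⇒outdeg≥ graph (to (r , w)) child
    (λ e → ∷ʳ-injectiveʳ w shallow (cong proj₂ (to-injective e)))
    (λ c → Arc⇒Edge (inj₂ (parent-child c , child-deeper c)))
    where
    child : Fin a → Fin order
    child c = to (r , w ∷ʳ c)

    parent-child : ∀ c → to (r , w) ≡ parent (child c)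
    parent-child c = cong to (sym (trans (cong (map₂ init) (strictlyInverseʳ (r , w ∷ʳ c)))
                                         (cong (r ,_) (init-∷ʳ w c shallow))))

    child-deeper : ∀ c → depthOf (child c) ≡ suc (depthOf (to (r , w)))
    child-deeper c = begin
      depthOf (child c)          ≡⟨ depthOf-to r (w ∷ʳ c) ⟩
      depth (w ∷ʳ c)             ≡⟨ depth-∷ʳ w c shallow ⟩
      suc (depth w)              ≡⟨ cong suc (depthOf-to r w) ⟨
      suc (depthOf (to (r , w))) ∎
      where open ≡-Reasoning

  graph-minOutDeg : MinOutDeg≥ graph a
  graph-minOutDeg x = by-depth (depthOf x ℕ.≟ suc K)
    where
    by-depth : Dec (depthOf x ≡ suc K) → a ≤ outdeg graph x
    by-depth (yes leaf) = leaf-outdeg≥ x leaf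
    by-depth (no ¬leaf) = subst (λ y → a ≤ outdeg graph y) (strictlyInverseˡ x)
      (inner-outdeg≥ (proj₁ (from x)) (proj₂ (from x)) (ℕ.≤∧≢⇒< (depth≤ (proj₂ (from x))) ¬leaf))

  level : Fin order → ℤ
  level x = + depthOf x

  level-heightModulo : IsHeightFunctionModulo (suc (suc K)) graph level
  level-heightModulo x y e with Edge⇒Arc e
  ... | inj₁ (leaf , root) = successor-mod⇒∣ (inj₁ (cong suc leaf , root))
  ... | inj₂ (_ , deeper)  = successor-mod⇒∣ (inj₂ deeper)

  merging⇒level≡0 : ∀ y → 2 ≤ indeg graph y → level y ≡ 0ℤ
  merging⇒level≡0 y merging = by-depth (depthOf y ℕ.≟ 0)
    where
    by-depth : Dec (depthOf y ≡ 0) → level y ≡ 0ℤ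
    by-depth (yes root) = cong +_ root
    by-depth (no ¬root) =
      contradiction merging (ℕ.≤⇒≯ (unique-in-neighbour⇒indeg≤1 graph y (parent y) only-parent))
      where
      only-parent : ∀ x → Edge graph x y → x ≡ parent y
      only-parent x e with Edge⇒Arc e
      ... | inj₁ (_ , root)       = contradiction root ¬root
      ... | inj₂ (x≡parent , _)   = x≡parent

theorem1p3 : ∀ {m} (Tr : Digraph (suc m)) → IsOrientedTree Tr →
    Σ ℕ (λ d → ∀ n (G : Digraph (suc n)) → MinOutDeg≥ G d → Contains G Tr) →
    Grounded Tr
theorem1p3 Tr tree (d , embeds) h h-height u v u-merging v-merging =
  i-j≡0⇒i≡j (h u) (h v) (k∣i∧∣i∣<k⇒i≡0 k∣δ (ℕ.m<n⇒m<1+n (ℕ.n<1+n ℤ.∣ h u - h v ∣)))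
  where
  -- Arity suc d rather than d makes the order of the graph a successor.
  open CyclicForest (suc d) ℤ.∣ h u - h v ∣

  k∣δ : + suc (suc ℤ.∣ h u - h v ∣) ∣ h u - h v
  k∣δ = merging-heights-congruent {Tr = Tr} {G = graph} (IsOrientedTree.connected tree)
          (embeds _ graph (λ x → ℕ.≤-trans (ℕ.n≤1+n d) (graph-minOutDeg x)))
          h-height level-heightModulo merging⇒level≡0 u v u-merging v-merging
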